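{- Let $d\ge 2$ be an integer and let $G$ be the $d$-regular (infinite) tree. Then $G$ admits a harmonic labeling, i.e. there is a bijection $\phi:V(G)\to\mathbb{Z}$ such that $\phi(x)=\frac{1}{d}\sum_{y\sim x}\phi(y)$ for every vertex $x$.
   Context: For a graph $G=(V,E)$ in which every vertex has finite degree, a function $\phi:V\to\mathbb{Z}$ is harmonic if $\phi(x)=\frac{1}{\deg(x)}\sum_{y\sim x}\phi(y)$ for all $x\in V$, where the sum is over the neighbours $y$ of $x$. A harmonic labeling of $G$ is a harmonic function $\phi:V\to\mathbb{Z}$ that is injective and surjective onto $\mathbb{Z}$. -}

module Defs where

open import Data.Nat using (ℕ; suc; pred)
open import Data.Integer using (ℤ; _+_; _*_; +_)
open import Data.Fin using (Fin)
open import Data.List using (List; []; _∷_; map; foldr; length)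
open import Data.Product using (_×_; _,_)
open import Relation.Binary.PropositionalEquality using (_≡_)
open import Function.Definitions using (Bijective)

sumℤ : List ℤ → ℤ
sumℤ = foldr _+_ (+ 0)

allFin : (n : ℕ) → List (Fin n)
allFin n = Data.List.tabulate {n = n} (λ i → i)
  where import Data.List

-- A locally finite graph, given by its vertex type and, for each vertex,
-- the (finite, duplicate-free) list of its neighbours.
record LocFinGraph : Set₁ where
  field
    V    : Set
    nbrs : V → List V

open LocFinGraph public

deg : (G : LocFinGraph) → V G → ℕ
deg G x = length (nbrs G x)

-- φ harmonic: φ(x) = (1/deg x) Σ_{y ~ x} φ(y), written with the
-- (nonzero) denominator cleared: deg(x) · φ(x) = Σ_{y ~ x} φ(y).
Harmonic : (G : LocFinGraph) → (V G → ℤ) → Set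
Harmonic G φ = ∀ x → (+ deg G x) * φ x ≡ sumℤ (map φ (nbrs G x))

HarmonicLabeling : (G : LocFinGraph) → (V G → ℤ) → Set
HarmonicLabeling G φ = Harmonic G φ × Bijective _≡_ _≡_ φ

-- Vertices: the root, or (i , ws) = go to the i-th child of the root
-- (i : Fin d) and then descend along ws (most recent step at the head),
-- each step choosing one of the d-1 children of a non-root vertex.
data TreeV (d : ℕ) : Set where
  root : TreeV d
  node : Fin d → List (Fin (pred d)) → TreeV d

treeNbrs : (d : ℕ) → TreeV d → List (TreeV d)
treeNbrs d root = map (λ i → node i []) (allFin d)
treeNbrs d (node i []) =
  root ∷ map (λ j → node i (j ∷ [])) (allFin (pred d))
treeNbrs d (node i (k ∷ ws)) =
  node i ws ∷ map (λ j → node i (j ∷ k ∷ ws)) (allFin (pred d))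

RegularTree : ℕ → LocFinGraph
RegularTree d = record { V = TreeV d ; nbrs = treeNbrs d }

module Submission where

-- For d = 2 the tree is a bi-infinite path and the signed distance from the
-- root works.  For d = e + 3 the labeling is the limit of a greedy
-- construction in stages.  Stage ℓ visits each vertex x of depth 2ℓ, whose
-- value v and parent value p are already known, and labels its children and
-- grandchildren: the children get distinct values summing to d·v − p (so x
-- becomes harmonic), and the grandchildren below each child c get distinct
-- values summing to d·φ(c) − v (so c becomes harmonic).  The first grandchild
-- receives the ℓ-th integer of an enumeration of ℤ unless it is already used,
-- which makes the labeling surjective; every other new value is "fresh",
-- larger in absolute value than everything used before, which makes it
-- injective.  When d = 3 a child has only two children, and the remaining
-- forced value is shown fresh by a size estimate (forced-escapes).

open import Defs
open import Data.Nat as N using (ℕ; zero; suc; _≤_; _<_; _≥_; z≤n; s≤s; _⊔_; _≤′_; ≤′-reflexive; ≤′-step)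
import Data.Nat.Properties as NP
open import Data.Nat.Tactic.RingSolver as NatSolver using ()
open import Data.Integer as Z using (ℤ; +_; -[1+_]; ∣_∣)
import Data.Integer.Properties as ZP
open import Data.Integer.Tactic.RingSolver using (solve-∀)
open import Data.Fin as F using (Fin)
open import Data.Vec using (Vec; []; _∷_; toList; lookup; tabulate; tail)
import Data.Vec.Properties as VP
open import Data.List as L using (List; []; _∷_; map; length; _++_; concatMap; replicate; foldl)
import Data.List.Properties as LP
open import Data.List.Relation.Unary.All as All using (All; []; _∷_)
import Data.List.Relation.Unary.All.Properties as AllP
open import Data.List.Relation.Unary.Any as Any using (here; there)
open import Data.List.Relation.Unary.AllPairs using ([]; _∷_)
open import Data.List.Relation.Unary.Unique.Propositional using (Unique)
import Data.List.Relation.Unary.Unique.Propositional.Properties as UniqueP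
open import Data.List.Relation.Binary.Pointwise as PW using (Pointwise; []; _∷_)
open import Data.List.Membership.Propositional using (_∈_; _∉_; find)
open import Data.List.Membership.Propositional.Properties
import Data.List.Membership.DecPropositional as DecMembership
open import Data.Product using (Σ; ∃; _×_; _,_; proj₁; proj₂)
open import Data.Sum using (_⊎_; inj₁; inj₂)
open import Data.Empty using (⊥; ⊥-elim)
open import Relation.Binary.PropositionalEquality
open import Relation.Binary.Definitions using (DecidableEquality; tri<; tri≈; tri>)
open import Relation.Nullary using (yes; no)
open import Function.Definitions using (Injective; Surjective)

-- For d = 2 the tree is the bi-infinite path
--   … – node 1 [0] – node 1 [] – root – node 0 [] – node 0 [0] – …
-- and the signed distance from the root is a harmonic labeling.
module Path where

  signedDepth : TreeV 2 → ℤ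
  signedDepth root = + 0
  signedDepth (node F.zero ws) = + suc (length ws)
  signedDepth (node (F.suc F.zero) ws) = -[1+ length ws ]

  -- On a path, a function that moves by ±1 per step is harmonic; with the
  -- list-based neighbour sums these are the identities 2(a+2) = (a+1) + (a+3)
  -- on the positive side and its negation on the negative side.
  increasing-harmonic : ∀ a → + 2 Z.* (+ 2 Z.+ a) ≡ (+ 1 Z.+ a) Z.+ ((+ 3 Z.+ a) Z.+ + 0)
  increasing-harmonic = solve-∀

  decreasing-harmonic : ∀ a →
    + 2 Z.* Z.- (+ 2 Z.+ a) ≡ Z.- (+ 1 Z.+ a) Z.+ (Z.- (+ 3 Z.+ a) Z.+ + 0)
  decreasing-harmonic = solve-∀

  signedDepth-harmonic : Harmonic (RegularTree 2) signedDepth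
  signedDepth-harmonic root = refl
  signedDepth-harmonic (node F.zero []) = refl
  signedDepth-harmonic (node F.zero (_ ∷ ws)) = increasing-harmonic (+ length ws)
  signedDepth-harmonic (node (F.suc F.zero) []) = refl
  signedDepth-harmonic (node (F.suc F.zero) (_ ∷ ws)) = decreasing-harmonic (+ length ws)

  -- The inverse of signedDepth: a path vertex is determined by its side and
  -- its distance from the root, since Fin 1 has a single element.
  vertexAt : ℤ → TreeV 2
  vertexAt (+ zero) = root
  vertexAt (+ suc n) = node F.zero (replicate n F.zero)
  vertexAt -[1+ n ] = node (F.suc F.zero) (replicate n F.zero)

  replicate-length : (ws : List (Fin 1)) → replicate (length ws) F.zero ≡ ws
  replicate-length [] = refl
  replicate-length (F.zero ∷ ws) = cong (F.zero ∷_) (replicate-length ws)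

  vertexAt-signedDepth : ∀ x → vertexAt (signedDepth x) ≡ x
  vertexAt-signedDepth root = refl
  vertexAt-signedDepth (node F.zero ws) = cong (node F.zero) (replicate-length ws)
  vertexAt-signedDepth (node (F.suc F.zero) ws) = cong (node (F.suc F.zero)) (replicate-length ws)

  signedDepth-vertexAt : ∀ z → signedDepth (vertexAt z) ≡ z
  signedDepth-vertexAt (+ zero) = refl
  signedDepth-vertexAt (+ suc n) = cong (λ k → + suc k) (LP.length-replicate n)
  signedDepth-vertexAt -[1+ n ] = cong -[1+_] (LP.length-replicate n)

  pathLabeling : HarmonicLabeling (RegularTree 2) signedDepth
  pathLabeling = signedDepth-harmonic , injective , surjective
    where
    injective : Injective _≡_ _≡_ signedDepth
    injective {x} {y} eq = begin
      x                         ≡⟨ vertexAt-signedDepth x ⟨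
      vertexAt (signedDepth x)  ≡⟨ cong vertexAt eq ⟩
      vertexAt (signedDepth y)  ≡⟨ vertexAt-signedDepth y ⟩
      y                         ∎
      where open ≡-Reasoning
    surjective : Surjective _≡_ _≡_ signedDepth
    surjective z = vertexAt z , λ { refl → signedDepth-vertexAt z }

module ListFacts where

  pointwise-tabulate : ∀ {A B : Set} {R : A → B → Set} {n} (f : Fin n → A) (g : Fin n → B) →
    (∀ i → R (f i) (g i)) → ∀ is → Pointwise R (map f is) (map g is)
  pointwise-tabulate f g fRg [] = []
  pointwise-tabulate f g fRg (i ∷ is) = fRg i ∷ pointwise-tabulate f g fRg is

  pointwise-∈ : ∀ {A B : Set} {R : A → B → Set} {xs ys x} → Pointwise R xs ys → x ∈ xs → ∃ λ y → R x y
  pointwise-∈ (r ∷ _) (here refl) = _ , r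
  pointwise-∈ (_ ∷ rs) (there x∈) = pointwise-∈ rs x∈

  length-map-allFin : ∀ {A : Set} n (f : Fin n → A) → length (map f (allFin n)) ≡ n
  length-map-allFin n f = trans (LP.length-map f (allFin n)) (LP.length-tabulate (λ i → i))

  tabulate∘lookup≡toList : ∀ {A : Set} {n} (w : Vec A n) → L.tabulate (lookup w) ≡ toList w
  tabulate∘lookup≡toList [] = refl
  tabulate∘lookup≡toList (a ∷ w) = cong (a ∷_) (tabulate∘lookup≡toList w)

  lookup-tail : ∀ {A : Set} {n} (w : Vec A (suc n)) i → lookup (tail w) i ≡ lookup w (F.suc i)
  lookup-tail (a ∷ w) i = refl

-- Fresh splits.  freshSplit n X B lists n + 1 pairwise distinct integers with
-- sum X, all of absolute value above B (for n = 0 this needs B < ∣ X ∣) and at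
-- most freshBound n X B.  All but the last two summands are +(B+1), +(B+2), …;
-- the last two are given opposite signs, the smaller one of size one more than
-- the previous summand, so that both are large whatever the remaining sum is.
module FreshSplit where

  sumV : ∀ {n} → Vec ℤ n → ℤ
  sumV v = sumℤ (toList v)

  freshSplit : (n : ℕ) → ℤ → ℕ → Vec ℤ (suc n)
  freshSplit zero X B = X ∷ []
  freshSplit (suc zero) (+ a) B = -[1+ B ] ∷ + (suc B N.+ a) ∷ []
  freshSplit (suc zero) -[1+ a ] B = + suc B ∷ Z.- (+ (suc B N.+ suc a)) ∷ []
  freshSplit (suc (suc n)) X B = + suc B ∷ freshSplit (suc n) (X Z.- + suc B) (suc B)

  freshBound : ℕ → ℤ → ℕ → ℕ
  freshBound zero X B = B N.+ ∣ X ∣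
  freshBound (suc zero) X B = suc B N.+ ∣ X ∣
  freshBound (suc (suc n)) X B = freshBound (suc n) (X Z.- + suc B) (suc B)

  freshSplit-sum : ∀ n X B → sumV (freshSplit n X B) ≡ X
  freshSplit-sum zero X B = ZP.+-identityʳ X
  freshSplit-sum (suc zero) (+ a) B =
    trans (cong (λ w → -[1+ B ] Z.+ (w Z.+ + 0)) (ZP.pos-+ (suc B) a)) (cancel (+ suc B) (+ a))
    where
    cancel : ∀ i j → Z.- i Z.+ ((i Z.+ j) Z.+ + 0) ≡ j
    cancel = solve-∀
  freshSplit-sum (suc zero) -[1+ a ] B =
    trans (cong (λ w → + suc B Z.+ (Z.- w Z.+ + 0)) (ZP.pos-+ (suc B) (suc a))) (cancel (+ suc B) (+ suc a))
    where
    cancel : ∀ i j → i Z.+ (Z.- (i Z.+ j) Z.+ + 0) ≡ Z.- j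
    cancel = solve-∀
  freshSplit-sum (suc (suc n)) X B =
    trans (cong (λ w → + suc B Z.+ w) (freshSplit-sum (suc n) (X Z.- + suc B) (suc B))) (cancel X (+ suc B))
    where
    cancel : ∀ i j → j Z.+ (i Z.- j) ≡ i
    cancel = solve-∀

  freshSplit-above : ∀ n X B → (n ≡ 0 → B < ∣ X ∣) → All (λ z → B < ∣ z ∣) (toList (freshSplit n X B))
  freshSplit-above zero X B large = large refl ∷ []
  freshSplit-above (suc zero) (+ a) B _ = NP.≤-refl ∷ s≤s (NP.m≤m+n B a) ∷ []
  freshSplit-above (suc zero) -[1+ a ] B _ = NP.≤-refl ∷ s≤s (NP.m≤m+n B (suc a)) ∷ []
  freshSplit-above (suc (suc n)) X B _ =
    NP.≤-refl ∷ All.map NP.<⇒≤ (freshSplit-above (suc n) _ (suc B) (λ ()))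

  freshBound-≥ : ∀ n X B → B ≤ freshBound n X B
  freshBound-≥ zero X B = NP.m≤m+n B _
  freshBound-≥ (suc zero) X B = NP.≤-trans (NP.n≤1+n B) (NP.m≤m+n (suc B) _)
  freshBound-≥ (suc (suc n)) X B = NP.≤-trans (NP.n≤1+n B) (freshBound-≥ (suc n) _ (suc B))

  freshSplit-below : ∀ n X B → All (λ z → ∣ z ∣ ≤ freshBound n X B) (toList (freshSplit n X B))
  freshSplit-below zero X B = NP.m≤n+m ∣ X ∣ B ∷ []
  freshSplit-below (suc zero) (+ a) B = NP.m≤m+n (suc B) a ∷ NP.≤-refl ∷ []
  freshSplit-below (suc zero) -[1+ a ] B = NP.m≤m+n (suc B) (suc a) ∷ NP.≤-refl ∷ []
  freshSplit-below (suc (suc n)) X B =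
    freshBound-≥ (suc n) _ (suc B) ∷ freshSplit-below (suc n) _ (suc B)

  -- Distinctness: the head +(B+1) is smaller in absolute value than the rest.
  freshSplit-unique : ∀ n X B → Unique (toList (freshSplit n X B))
  freshSplit-unique zero X B = [] ∷ []
  freshSplit-unique (suc zero) (+ a) B = ((λ ()) ∷ []) ∷ [] ∷ []
  freshSplit-unique (suc zero) -[1+ a ] B = ((λ ()) ∷ []) ∷ [] ∷ []
  freshSplit-unique (suc (suc n)) X B =
    All.map (λ above eq → NP.<-irrefl (cong ∣_∣ eq) above) (freshSplit-above (suc n) _ (suc B) (λ ()))
    ∷ freshSplit-unique (suc n) _ (suc B)

  freshSplit-head : ∀ n X B → ∣ lookup (freshSplit (suc n) X B) F.zero ∣ ≡ suc B
  freshSplit-head zero (+ a) B = refl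
  freshSplit-head zero -[1+ a ] B = refl
  freshSplit-head (suc n) X B = refl

  freshBound-small : ∀ c X B → c ≤ 1 → freshBound (suc c) X B ≤ suc (suc B) N.+ (∣ X ∣ N.+ suc B)
  freshBound-small zero X B _ =
    NP.≤-trans (NP.n≤1+n _) (NP.+-monoʳ-≤ (suc (suc B)) (NP.m≤m+n ∣ X ∣ (suc B)))
  freshBound-small (suc zero) X B _ = NP.+-monoʳ-≤ (suc (suc B)) (ZP.∣i-j∣≤∣i∣+∣j∣ X (+ suc B))
  freshBound-small (suc (suc c)) X B (s≤s ())

  ∣a+b+c∣≤ : ∀ (a b c : ℤ) → ∣ a Z.+ b Z.+ c ∣ ≤ ∣ a ∣ N.+ (∣ b ∣ N.+ ∣ c ∣)
  ∣a+b+c∣≤ a b c = NP.≤-trans (ZP.∣i+j∣≤∣i∣+∣j∣ (a Z.+ b) c)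
    (NP.≤-trans (NP.+-monoˡ-≤ ∣ c ∣ (ZP.∣i+j∣≤∣i∣+∣j∣ a b)) (NP.≤-reflexive (NP.+-assoc (∣ a ∣) (∣ b ∣) (∣ c ∣))))

  -- The key estimate when a vertex has only two children (d = 3): if y has
  -- size B + 1 with B > ∣ v ∣ + ∣ h ∣ + ∣ S ∣, then D·y − v − h (D ≥ 3) is
  -- larger than every summand of a fresh split of S above B into ≤ 3 parts.
  forced-escapes : ∀ D c S v h y B → 3 ≤ D → c ≤ 1 →
    ∣ v ∣ N.+ (∣ h ∣ N.+ ∣ S ∣) < B → ∣ y ∣ ≡ suc B →
    freshBound (suc c) S B < ∣ + D Z.* y Z.- v Z.- h ∣
  forced-escapes D c S v h y B 3≤D c≤1 B-large ∣y∣ = NP.≰⇒> too-small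
    where
    X = + D Z.* y Z.- v Z.- h
    lower : 3 N.* suc B ≤ ∣ X ∣ N.+ (∣ v ∣ N.+ ∣ h ∣)
    lower = begin
      3 N.* suc B            ≤⟨ NP.*-monoˡ-≤ (suc B) 3≤D ⟩
      D N.* suc B            ≡⟨ cong (D N.*_) ∣y∣ ⟨
      D N.* ∣ y ∣            ≡⟨ ZP.abs-* (+ D) y ⟨
      (∣ + D Z.* y ∣)        ≡⟨ cong ∣_∣ (reassemble (+ D Z.* y) v h) ⟩
      (∣ X Z.+ v Z.+ h ∣)    ≤⟨ ∣a+b+c∣≤ X v h ⟩
      ∣ X ∣ N.+ (∣ v ∣ N.+ ∣ h ∣) ∎
      where
      open NP.≤-Reasoning
      reassemble : ∀ p q r → p ≡ p Z.- q Z.- r Z.+ q Z.+ r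
      reassemble = solve-∀
    -- ∣ X ∣ ≤ 2B + ∣ S ∣ + 3 would force B ≤ ∣ v ∣ + ∣ h ∣ + ∣ S ∣.
    too-small : ∣ X ∣ ≤ freshBound (suc c) S B → ⊥
    too-small X-small = NP.<⇒≱ B-large (NP.+-cancelˡ-≤ (3 N.+ 2 N.* B) _ _ (begin
      3 N.+ 2 N.* B N.+ B                                    ≡⟨ lhs B ⟩
      3 N.* suc B                                            ≤⟨ lower ⟩
      ∣ X ∣ N.+ (∣ v ∣ N.+ ∣ h ∣)                            ≤⟨ NP.+-monoˡ-≤ _ X-bounded ⟩
      suc (suc B) N.+ (∣ S ∣ N.+ suc B) N.+ (∣ v ∣ N.+ ∣ h ∣) ≡⟨ rhs B (∣ S ∣) (∣ v ∣) (∣ h ∣) ⟩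
      3 N.+ 2 N.* B N.+ (∣ v ∣ N.+ (∣ h ∣ N.+ ∣ S ∣))        ∎))
      where
      open NP.≤-Reasoning
      X-bounded : ∣ X ∣ ≤ suc (suc B) N.+ (∣ S ∣ N.+ suc B)
      X-bounded = NP.≤-trans X-small (freshBound-small c S B c≤1)
      lhs : ∀ B → 3 N.+ 2 N.* B N.+ B ≡ 3 N.* suc B
      lhs = NatSolver.solve-∀
      rhs : ∀ B s a b → suc (suc B) N.+ (s N.+ suc B) N.+ (a N.+ b) ≡ 3 N.+ 2 N.* B N.+ (a N.+ (b N.+ s))
      rhs = NatSolver.solve-∀

-- The enumeration 0, −1, 1, −2, 2, … of ℤ; stage ℓ tries to place enumℤ ℓ.
module Enumeration where

  next : ℤ → ℤ
  next (+ n) = + suc n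
  next -[1+ n ] = -[1+ suc n ]

  enumℤ : ℕ → ℤ
  enumℤ zero = + 0
  enumℤ (suc zero) = -[1+ 0 ]
  enumℤ (suc (suc k)) = next (enumℤ k)

  enumℤ-surjective : ∀ z → ∃ λ k → enumℤ k ≡ z
  enumℤ-surjective (+ zero) = 0 , refl
  enumℤ-surjective (+ suc n) with enumℤ-surjective (+ n)
  ... | k , eq = suc (suc k) , cong next eq
  enumℤ-surjective -[1+ zero ] = 1 , refl
  enumℤ-surjective -[1+ suc n ] with enumℤ-surjective -[1+ n ]
  ... | k , eq = suc (suc k) , cong next eq

-- The rooted model of the (e+3)-regular tree: the root has d = e + 3
-- children and every other vertex has a parent and m = e + 2 children.
module Tree (e : ℕ) where

  d : ℕ
  d = suc (suc (suc e))

  m : ℕ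
  m = suc (suc e)

  T : Set
  T = TreeV d

  depth : T → ℕ
  depth root = 0
  depth (node i ws) = suc (length ws)

  parent : T → T
  parent root = root
  parent (node i []) = root
  parent (node i (k ∷ ws)) = node i ws

  -- Every vertex has at least two children; extra x counts the others.
  extra : T → ℕ
  extra root = suc e
  extra (node _ _) = e

  arity : T → ℕ
  arity x = suc (suc (extra x))

  child : (x : T) → Fin (arity x) → T
  child root i = node i []
  child (node i ws) j = node i (j ∷ ws)

  -- The k-th child of a non-root vertex (only ever applied to children).
  down : T → Fin m → T
  down root k = root
  down (node i ws) k = node i (k ∷ ws)

  _≟T_ : DecidableEquality T
  root ≟T root = yes refl
  root ≟T node _ _ = no λ ()
  node _ _ ≟T root = no λ ()
  node i ws ≟T node i' ws' with i F.≟ i' | LP.≡-dec F._≟_ ws ws'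
  ... | yes refl | yes refl = yes refl
  ... | no i≢i' | _ = no λ { refl → i≢i' refl }
  ... | _ | no ws≢ws' = no λ { refl → ws≢ws' refl }

  depth-child : ∀ x j → depth (child x j) ≡ suc (depth x)
  depth-child root j = refl
  depth-child (node i ws) j = refl

  depth-grandchild : ∀ x j k → depth (down (child x j) k) ≡ suc (suc (depth x))
  depth-grandchild root j k = refl
  depth-grandchild (node i ws) j k = refl

  depth-node : ∀ i ws → depth (node i ws) ≡ suc (depth (parent (node i ws)))
  depth-node i [] = refl
  depth-node i (k ∷ ws) = refl

  parent-child : ∀ x j → parent (child x j) ≡ x
  parent-child root j = refl
  parent-child (node i ws) j = refl

  parent-grandchild : ∀ x j k → parent (down (child x j) k) ≡ child x j
  parent-grandchild root j k = refl
  parent-grandchild (node i ws) j k = refl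

  child-injective : ∀ x {j j'} → child x j ≡ child x j' → j ≡ j'
  child-injective root refl = refl
  child-injective (node i ws) refl = refl

  grandchild-injective : ∀ x {j j' k k'} → down (child x j) k ≡ down (child x j') k' → j ≡ j' × k ≡ k'
  grandchild-injective root refl = refl , refl
  grandchild-injective (node i ws) refl = refl , refl

  node-is-child : ∀ i ws → Σ (Fin (arity (parent (node i ws)))) λ j → node i ws ≡ child (parent (node i ws)) j
  node-is-child i [] = i , refl
  node-is-child i (k ∷ ws) = k , refl

  nbrs-child : ∀ x j → treeNbrs d (child x j) ≡ x ∷ map (down (child x j)) (allFin m)
  nbrs-child root j = refl
  nbrs-child (node i ws) j = refl

  nbrs-node : ∀ i ws → treeNbrs d (node i ws) ≡ parent (node i ws) ∷ map (child (node i ws)) (allFin m)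
  nbrs-node i [] = refl
  nbrs-node i (k ∷ ws) = refl

  node∈nbrs-parent : ∀ i ws → node i ws ∈ treeNbrs d (parent (node i ws))
  node∈nbrs-parent i [] = ∈-map⁺ (λ i → node i []) (∈-allFin i)
  node∈nbrs-parent i (k ∷ ws) rewrite nbrs-node i ws = there (∈-map⁺ (λ j → node i (j ∷ ws)) (∈-allFin k))

  -- Below x y: y is a child or a grandchild of x.  These are exactly the
  -- vertices labelled when x is processed.
  Below : T → T → Set
  Below x y = (Σ (Fin (arity x)) λ j → y ≡ child x j)
            ⊎ (Σ (Fin (arity x)) λ j → Σ (Fin m) λ k → y ≡ down (child x j) k)

  Below-deeper : ∀ {x y} → Below x y → depth x < depth y
  Below-deeper {x} (inj₁ (j , refl)) = NP.≤-reflexive (sym (depth-child x j))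
  Below-deeper {x} (inj₂ (j , k , refl)) = NP.≤-trans (NP.n≤1+n _) (NP.≤-reflexive (sym (depth-grandchild x j k)))

  Below-shallow : ∀ {x y} → Below x y → depth y ≤ suc (suc (depth x))
  Below-shallow {x} (inj₁ (j , refl)) = NP.≤-trans (NP.≤-reflexive (depth-child x j)) (NP.n≤1+n _)
  Below-shallow {x} (inj₂ (j , k , refl)) = NP.≤-reflexive (depth-grandchild x j k)

  child≢grandchild : ∀ {x x'} j j' k' → depth x ≡ depth x' → child x j ≢ down (child x' j') k'
  child≢grandchild {x} {x'} j j' k' same eq = NP.1+n≢n (sym (NP.suc-injective (begin
    suc (depth x)                    ≡⟨ depth-child x j ⟨
    depth (child x j)                ≡⟨ cong depth eq ⟩
    depth (down (child x' j') k')    ≡⟨ depth-grandchild x' j' k' ⟩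
    suc (suc (depth x'))             ≡⟨ cong (λ n → suc (suc n)) same ⟨
    suc (suc (depth x))              ∎)))
    where open ≡-Reasoning

  Below-unique : ∀ {x x' y} → depth x ≡ depth x' → Below x y → Below x' y → x ≡ x'
  Below-unique {x} {x'} _ (inj₁ (j , refl)) (inj₁ (j' , eq)) = begin
    x                        ≡⟨ parent-child x j ⟨
    parent (child x j)       ≡⟨ cong parent eq ⟩
    parent (child x' j')     ≡⟨ parent-child x' j' ⟩
    x'                       ∎
    where open ≡-Reasoning
  Below-unique {x} {x'} _ (inj₂ (j , k , refl)) (inj₂ (j' , k' , eq)) = begin
    x                                          ≡⟨ parent-child x j ⟨
    parent (child x j)                         ≡⟨ cong parent (parent-grandchild x j k) ⟨
    parent (parent (down (child x j) k))       ≡⟨ cong (λ t → parent (parent t)) eq ⟩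
    parent (parent (down (child x' j') k'))    ≡⟨ cong parent (parent-grandchild x' j' k') ⟩
    parent (child x' j')                       ≡⟨ parent-child x' j' ⟩
    x'                                         ∎
    where open ≡-Reasoning
  Below-unique same (inj₁ (j , refl)) (inj₂ (j' , k' , eq)) = ⊥-elim (child≢grandchild j j' k' same eq)
  Below-unique same (inj₂ (j , k , refl)) (inj₁ (j' , eq)) = ⊥-elim (child≢grandchild j' j k (sym same) (sym eq))

  odd-level-child : ∀ ℓ y → depth y ≡ suc (ℓ N.+ ℓ) →
    Σ T λ x → depth x ≡ ℓ N.+ ℓ × Σ (Fin (arity x)) λ j → y ≡ child x j
  odd-level-child ℓ root ()
  odd-level-child ℓ (node i ws) dy with node-is-child i ws
  ... | j , y≡child = parent (node i ws) , NP.suc-injective (trans (sym (depth-node i ws)) dy) , j , y≡child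

  -- All words of length n over Fin m, and the list of all vertices at
  -- depth 2ℓ (written ℓ + ℓ), which are the vertices processed in stage ℓ.
  words : ℕ → List (List (Fin m))
  words zero = [] ∷ []
  words (suc n) = concatMap (λ ws → map (_∷ ws) (allFin m)) (words n)

  words-complete : ∀ ws → ws ∈ words (length ws)
  words-complete [] = here refl
  words-complete (k ∷ ws) =
    ∈-concatMap⁺ (λ ws → map (_∷ ws) (allFin m))
      (Any.map (λ { refl → ∈-map⁺ (_∷ ws) (∈-allFin k) }) (words-complete ws))

  words-sound : ∀ n ws → ws ∈ words n → length ws ≡ n
  words-sound zero ws (here refl) = refl
  words-sound (suc n) ws ws∈ with find (∈-concatMap⁻ (λ ws → map (_∷ ws) (allFin m)) {xs = words n} ws∈)
  ... | ws' , ws'∈ , ∈extensions with ∈-map⁻ (_∷ ws') ∈extensions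
  ... | k , _ , refl = cong suc (words-sound n ws' ws'∈)

  evenLevel : ℕ → List T
  evenLevel zero = root ∷ []
  evenLevel (suc ℓ) = concatMap (λ i → map (node i) (words (suc (ℓ N.+ ℓ)))) (allFin d)

  evenLevel-sound : ∀ ℓ x → x ∈ evenLevel ℓ → depth x ≡ ℓ N.+ ℓ
  evenLevel-sound zero x (here refl) = refl
  evenLevel-sound (suc ℓ) x x∈
    with find (∈-concatMap⁻ (λ i → map (node i) (words (suc (ℓ N.+ ℓ)))) {xs = allFin d} x∈)
  ... | i , _ , ∈branch with ∈-map⁻ (node i) ∈branch
  ... | ws , ws∈ , refl = cong suc (trans (words-sound _ ws ws∈) (sym (NP.+-suc ℓ ℓ)))

  evenLevel-complete : ∀ ℓ x → depth x ≡ ℓ N.+ ℓ → x ∈ evenLevel ℓ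
  evenLevel-complete zero root _ = here refl
  evenLevel-complete (suc ℓ) root ()
  evenLevel-complete zero (node i ws) ()
  evenLevel-complete (suc ℓ) (node i ws) eq =
    ∈-concatMap⁺ (λ i → map (node i) (words (suc (ℓ N.+ ℓ))))
      (Any.map (λ { refl → ∈-map⁺ (node i) (subst (λ n → ws ∈ words n) len (words-complete ws)) }) (∈-allFin i))
    where
    len : length ws ≡ suc (ℓ N.+ ℓ)
    len = NP.suc-injective (trans eq (cong suc (NP.+-suc ℓ ℓ)))

  evenLevel-inhabited : ∀ ℓ → ∃ λ x → x ∈ evenLevel ℓ
  evenLevel-inhabited zero = root , here refl
  evenLevel-inhabited (suc ℓ) = node F.zero (replicate (suc (ℓ N.+ ℓ)) F.zero) ,
    evenLevel-complete (suc ℓ) _ (cong suc (trans (LP.length-replicate (suc (ℓ N.+ ℓ))) (sym (NP.+-suc ℓ ℓ))))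

-- A log is a list of entries (vertex, value); the
-- construction only ever appends to a log and keeps it functional.
module Logs (e : ℕ) where
  open FreshSplit
  open ListFacts
  open Tree e

  Entry : Set
  Entry = T × ℤ

  Log : Set
  Log = List Entry

  values : Log → List ℤ
  values = map proj₂

  values-⊆ : ∀ {Lg Lg'} → (∀ {en} → en ∈ Lg → en ∈ Lg') → ∀ {z} → z ∈ values Lg → z ∈ values Lg'
  values-⊆ Lg⊆Lg' z∈ with ∈-map⁻ proj₂ z∈
  ... | en , en∈ , refl = ∈-map⁺ proj₂ (Lg⊆Lg' en∈)

  -- The value recorded for y (the first entry for y; 0 if there is none).
  valueIn : T → Log → ℤ
  valueIn y [] = + 0
  valueIn y ((y' , z) ∷ Lg) with y ≟T y'
  ... | yes _ = z
  ... | no _ = valueIn y Lg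

  valueIn-∈ : ∀ {y z} Lg → (y , z) ∈ Lg → (y , valueIn y Lg) ∈ Lg
  valueIn-∈ {y} ((y' , z') ∷ Lg) p with y ≟T y'
  ... | yes refl = here refl
  valueIn-∈ {y} ((y' , z') ∷ Lg) (here refl) | no y≢y' = ⊥-elim (y≢y' refl)
  valueIn-∈ {y} ((y' , z') ∷ Lg) (there p) | no _ = there (valueIn-∈ Lg p)

  -- The value of the parent (0 at the root, which has no parent).
  parentValue : T → Log → ℤ
  parentValue root Lg = + 0
  parentValue (node i ws) Lg = valueIn (parent (node i ws)) Lg

  zipEntries : ∀ {n} → Vec T n → Vec ℤ n → Log
  zipEntries [] [] = []
  zipEntries (y ∷ ys) (z ∷ zs) = (y , z) ∷ zipEntries ys zs

  gridEntries : ∀ {n} → Vec T n → Vec (Vec ℤ m) n → Log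
  gridEntries [] [] = []
  gridEntries (y ∷ ys) (g ∷ gs) = gridEntries ys gs ++ zipEntries (tabulate (down y)) g

  values-zipEntries : ∀ {n} (ys : Vec T n) zs → values (zipEntries ys zs) ≡ toList zs
  values-zipEntries [] [] = refl
  values-zipEntries (y ∷ ys) (z ∷ zs) = cong (z ∷_) (values-zipEntries ys zs)

  zipEntries-∈⁻ : ∀ {n} (ys : Vec T n) zs {y z} → (y , z) ∈ zipEntries ys zs →
    Σ (Fin n) λ i → y ≡ lookup ys i × z ≡ lookup zs i
  zipEntries-∈⁻ [] [] ()
  zipEntries-∈⁻ (y ∷ ys) (z ∷ zs) (here refl) = F.zero , refl , refl
  zipEntries-∈⁻ (y ∷ ys) (z ∷ zs) (there p) with zipEntries-∈⁻ ys zs p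
  ... | i , a , b = F.suc i , a , b

  zipEntries-∈⁺ : ∀ {n} (ys : Vec T n) zs i → (lookup ys i , lookup zs i) ∈ zipEntries ys zs
  zipEntries-∈⁺ (y ∷ ys) (z ∷ zs) F.zero = here refl
  zipEntries-∈⁺ (y ∷ ys) (z ∷ zs) (F.suc i) = there (zipEntries-∈⁺ ys zs i)

  gridEntries-∈⁻ : ∀ {n} (ys : Vec T n) gs {y z} → (y , z) ∈ gridEntries ys gs →
    Σ (Fin n) λ j → Σ (Fin m) λ k → y ≡ down (lookup ys j) k × z ≡ lookup (lookup gs j) k
  gridEntries-∈⁻ [] [] ()
  gridEntries-∈⁻ (y ∷ ys) (g ∷ gs) p with ∈-++⁻ (gridEntries ys gs) p
  ... | inj₂ q with zipEntries-∈⁻ (tabulate (down y)) g q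
  ...   | k , a , b = F.zero , k , trans a (VP.lookup∘tabulate (down y) k) , b
  gridEntries-∈⁻ (y ∷ ys) (g ∷ gs) p | inj₁ q with gridEntries-∈⁻ ys gs q
  ...   | j , k , a , b = F.suc j , k , a , b

  gridEntries-∈⁺ : ∀ {n} (ys : Vec T n) gs j k →
    (down (lookup ys j) k , lookup (lookup gs j) k) ∈ gridEntries ys gs
  gridEntries-∈⁺ (y ∷ ys) (g ∷ gs) F.zero k =
    ∈-++⁺ʳ (gridEntries ys gs) (subst (λ w → (w , lookup g k) ∈ zipEntries (tabulate (down y)) g)
      (VP.lookup∘tabulate (down y) k) (zipEntries-∈⁺ (tabulate (down y)) g k))
  gridEntries-∈⁺ (y ∷ ys) (g ∷ gs) (F.suc j) k = ∈-++⁺ˡ (gridEntries-∈⁺ ys gs j k)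

  Fresh : List ℤ → ℕ → Set
  Fresh zs B = Unique zs × All (λ z → ∣ z ∣ ≤ B) zs

  Fresh-++ : ∀ {zs B} ws B' → Fresh zs B → Unique ws → All (λ z → B < ∣ z ∣) ws →
    All (λ z → ∣ z ∣ ≤ B') ws → B ≤ B' → Fresh (ws ++ zs) B'
  Fresh-++ ws B' (zs-unique , zs-small) ws-unique ws-large ws-small B≤B' =
    UniqueP.++⁺ ws-unique zs-unique
      (λ { (w∈ws , w∈zs) → NP.<-irrefl refl (NP.<-≤-trans (All.lookup ws-large w∈ws) (All.lookup zs-small w∈zs)) }) ,
    AllP.++⁺ ws-small (All.map (λ z-small → NP.≤-trans z-small B≤B') zs-small)

  -- Fresh splits of d·w − v for each w in a vector, threading the bound: the
  -- grandchild rows below all children but the first one.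
  splitRows : ℤ → ∀ {n} → Vec ℤ n → ℕ → Vec (Vec ℤ m) n × ℕ
  splitRows v [] B = [] , B
  splitRows v (w ∷ ws) B =
    freshSplit (suc e) (+ d Z.* w Z.- v) B ∷ proj₁ (splitRows v ws (freshBound (suc e) (+ d Z.* w Z.- v) B)) ,
    proj₂ (splitRows v ws (freshBound (suc e) (+ d Z.* w Z.- v) B))

  splitRows-fresh : ∀ v {n} (ys : Vec T n) ws B zs → Fresh zs B →
    Fresh (values (gridEntries ys (proj₁ (splitRows v ws B))) ++ zs) (proj₂ (splitRows v ws B))
  splitRows-fresh v [] [] B zs fresh = fresh
  splitRows-fresh v (y ∷ ys) (w ∷ ws) B zs fresh =
    subst (λ l → Fresh l _) eq
      (splitRows-fresh v ys ws B' (toList g ++ zs)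
        (Fresh-++ (toList g) B' fresh (freshSplit-unique (suc e) X B) (freshSplit-above (suc e) X B (λ ()))
          (freshSplit-below (suc e) X B) (freshBound-≥ (suc e) X B)))
    where
    X = + d Z.* w Z.- v
    B' = freshBound (suc e) X B
    g = freshSplit (suc e) X B
    rest = gridEntries ys (proj₁ (splitRows v ws B'))
    eq : values rest ++ (toList g ++ zs) ≡ values (rest ++ zipEntries (tabulate (down y)) g) ++ zs
    eq = trans (cong (λ l → values rest ++ (l ++ zs)) (sym (values-zipEntries (tabulate (down y)) g)))
          (trans (sym (LP.++-assoc (values rest) _ zs)) (cong (_++ zs) (sym (LP.map-++ proj₂ rest _))))

  splitRows-row : ∀ v {n} (ws : Vec ℤ n) B j →
    Σ ℕ λ B' → lookup (proj₁ (splitRows v ws B)) j ≡ freshSplit (suc e) (+ d Z.* lookup ws j Z.- v) B'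
  splitRows-row v (w ∷ ws) B F.zero = B , refl
  splitRows-row v (w ∷ ws) B (F.suc j) = splitRows-row v ws _ j

  sum-tabulate : ∀ {n} (f : Fin n → ℤ) (w : Vec ℤ n) → (∀ i → f i ≡ lookup w i) →
    sumℤ (map f (allFin n)) ≡ sumV w
  sum-tabulate f w f≡w = cong sumℤ
    (trans (LP.map-tabulate (λ i → i) f) (trans (LP.tabulate-cong f≡w) (tabulate∘lookup≡toList w)))

  extra≤1 : ∀ x → e ≡ 0 → extra x ≤ 1
  extra≤1 root refl = NP.≤-refl
  extra≤1 (node i ws) refl = z≤n

  open DecMembership Z._≟_ using () renaming (_∈?_ to _∈ℤ?_)

  -- One extension step: process the vertex x (whose value and parent value
  -- are in the log Lg, all of whose values are bounded by B), trying to place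
  -- the target t.  With v = φ(x) and p = φ(parent x):
  --  * the children get a fresh split of S = d·v − p above Bk (x harmonic);
  --  * the first grandchild of the first child gets placed (t if unused,
  --    else a fresh value), its other grandchildren a fresh split of
  --    X₀ = d·y₀ − v − placed, where y₀ is the value of the first child;
  --  * the grandchildren below each other child c get a fresh split of
  --    d·φ(c) − v, so every child is harmonic as well.
  -- B0 ≤ Bk ≤ B1 ≤ B2 ≤ B3 are the bounds on all values used so far.
  module Extend (t : ℤ) (x : T) (Lg : Log) (B : ℕ) where
    placed : ℤ
    placed with t ∈ℤ? values Lg
    ... | yes _ = + suc B
    ... | no _ = t

    placed-fresh : All (λ z → ∣ z ∣ ≤ B) (values Lg) → placed ∉ values Lg
    placed-fresh small with t ∈ℤ? values Lg
    ... | yes _ = λ q → NP.<-irrefl refl (All.lookup small q)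
    ... | no t∉ = t∉

    placed-target : t ∈ values Lg ⊎ placed ≡ t
    placed-target with t ∈ℤ? values Lg
    ... | yes t∈ = inj₁ t∈
    ... | no _ = inj₂ refl

    v p S : ℤ
    v = valueIn x Lg
    p = parentValue x Lg
    S = + d Z.* v Z.- p

    B0 Bk B1 B2 B3 : ℕ
    childValues : Vec ℤ (arity x)
    y₀ X₀ : ℤ
    firstRow : Vec ℤ (suc e)
    otherRows : Vec (Vec ℤ m) (suc (extra x))

    B0 = B N.+ ∣ placed ∣
    -- Bk exceeds ∣ v ∣ + ∣ placed ∣ + ∣ S ∣, as forced-escapes requires.
    Bk = suc (B0 N.+ (∣ v ∣ N.+ (∣ placed ∣ N.+ ∣ S ∣)))
    childValues = freshSplit (suc (extra x)) S Bk
    B1 = freshBound (suc (extra x)) S Bk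
    y₀ = lookup childValues F.zero
    X₀ = + d Z.* y₀ Z.- v Z.- placed
    firstRow = freshSplit e X₀ B1
    B2 = freshBound e X₀ B1
    otherRows = proj₁ (splitRows v (tail childValues) B2)
    B3 = proj₂ (splitRows v (tail childValues) B2)

    x₀ : T
    x₀ = child x F.zero

    grandchildValue : Fin (arity x) → Fin m → ℤ
    grandchildValue F.zero F.zero = placed
    grandchildValue F.zero (F.suc k) = lookup firstRow k
    grandchildValue (F.suc j) k = lookup (lookup otherRows j) k

    firstEntry : Entry
    firstEntry = (down x₀ F.zero , placed)
    childEntries firstRowEntries otherRowEntries extended : Log
    childEntries = zipEntries (tabulate (child x)) childValues
    firstRowEntries = zipEntries (tabulate (λ k → down x₀ (F.suc k))) firstRow
    otherRowEntries = gridEntries (tabulate (λ j → child x (F.suc j))) otherRows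
    extended = otherRowEntries ++ (firstRowEntries ++ (childEntries ++ (firstEntry ∷ Lg)))

    values-extended : values extended
      ≡ values otherRowEntries ++ (toList firstRow ++ (toList childValues ++ (placed ∷ values Lg)))
    values-extended =
      trans (LP.map-++ proj₂ otherRowEntries _) (cong (values otherRowEntries ++_)
        (trans (LP.map-++ proj₂ firstRowEntries _) (cong₂ _++_ (values-zipEntries _ firstRow)
          (trans (LP.map-++ proj₂ childEntries _) (cong (_++ (placed ∷ values Lg)) (values-zipEntries _ childValues))))))

    -- The single forced value X₀ of the first row is fresh even for d = 3.
    firstRow-above : e ≡ 0 → B1 < ∣ X₀ ∣
    firstRow-above e≡0 = forced-escapes d (extra x) S v placed y₀ Bk (s≤s (s≤s (s≤s z≤n))) (extra≤1 x e≡0)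
      (s≤s (NP.m≤n+m _ B0)) (freshSplit-head (extra x) S Bk)

    -- All values of the extended log are distinct: every new value is
    -- larger than every value used before it.
    extended-fresh : Fresh (values Lg) B → Fresh (values extended) B3
    extended-fresh (Lg-unique , Lg-small) = subst (λ zs → Fresh zs B3) (sym values-extended) with-rows
      where
      B0≤Bk : B0 ≤ Bk
      B0≤Bk = NP.≤-trans (NP.m≤m+n B0 _) (NP.n≤1+n _)
      with-placed : Fresh (placed ∷ values Lg) B0
      with-placed = (AllP.¬Any⇒All¬ _ (placed-fresh Lg-small) ∷ Lg-unique) ,
        (NP.m≤n+m ∣ placed ∣ B ∷ All.map (λ z-small → NP.≤-trans z-small (NP.m≤m+n B ∣ placed ∣)) Lg-small)
      with-children : Fresh (toList childValues ++ (placed ∷ values Lg)) B1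
      with-children = Fresh-++ (toList childValues) B1 with-placed (freshSplit-unique (suc (extra x)) S Bk)
        (All.map (NP.≤-<-trans B0≤Bk) (freshSplit-above (suc (extra x)) S Bk (λ ())))
        (freshSplit-below (suc (extra x)) S Bk) (NP.≤-trans B0≤Bk (freshBound-≥ (suc (extra x)) S Bk))
      with-first-row : Fresh (toList firstRow ++ (toList childValues ++ (placed ∷ values Lg))) B2
      with-first-row = Fresh-++ (toList firstRow) B2 with-children (freshSplit-unique e X₀ B1)
        (freshSplit-above e X₀ B1 firstRow-above) (freshSplit-below e X₀ B1) (freshBound-≥ e X₀ B1)
      with-rows : Fresh (values otherRowEntries ++ (toList firstRow ++ (toList childValues ++ (placed ∷ values Lg)))) B3
      with-rows = splitRows-fresh v (tabulate (λ j → child x (F.suc j))) (tail childValues) B2 _ with-first-row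

    NewEntry : T → ℤ → Set
    NewEntry y z = (Σ (Fin (arity x)) λ j → y ≡ child x j × z ≡ lookup childValues j)
                 ⊎ (Σ (Fin (arity x)) λ j → Σ (Fin m) λ k → y ≡ down (child x j) k × z ≡ grandchildValue j k)

    classify : ∀ {y z} → (y , z) ∈ extended → NewEntry y z ⊎ (y , z) ∈ Lg
    classify q with ∈-++⁻ otherRowEntries q
    ... | inj₁ q₁ with gridEntries-∈⁻ (tabulate (λ j → child x (F.suc j))) otherRows q₁
    ...   | j , k , a , b = inj₁ (inj₂ (F.suc j , k ,
            trans a (cong (λ w → down w k) (VP.lookup∘tabulate (λ j → child x (F.suc j)) j)) , b))
    classify q | inj₂ q₂ with ∈-++⁻ firstRowEntries q₂
    ... | inj₁ q₃ with zipEntries-∈⁻ (tabulate (λ k → down x₀ (F.suc k))) firstRow q₃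
    ...   | k , a , b = inj₁ (inj₂ (F.zero , F.suc k , trans a (VP.lookup∘tabulate (λ k → down x₀ (F.suc k)) k) , b))
    classify q | inj₂ q₂ | inj₂ q₄ with ∈-++⁻ childEntries q₄
    ... | inj₁ q₅ with zipEntries-∈⁻ (tabulate (child x)) childValues q₅
    ...   | j , a , b = inj₁ (inj₁ (j , trans a (VP.lookup∘tabulate (child x) j) , b))
    classify q | inj₂ q₂ | inj₂ q₄ | inj₂ (here refl) = inj₁ (inj₂ (F.zero , F.zero , refl , refl))
    classify q | inj₂ q₂ | inj₂ q₄ | inj₂ (there q₆) = inj₂ q₆

    old⊆extended : ∀ {en} → en ∈ Lg → en ∈ extended
    old⊆extended q = ∈-++⁺ʳ otherRowEntries (∈-++⁺ʳ firstRowEntries (∈-++⁺ʳ childEntries (there q)))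

    child∈extended : ∀ j → (child x j , lookup childValues j) ∈ extended
    child∈extended j = ∈-++⁺ʳ otherRowEntries (∈-++⁺ʳ firstRowEntries (∈-++⁺ˡ
      (subst (λ w → (w , lookup childValues j) ∈ childEntries) (VP.lookup∘tabulate (child x) j)
        (zipEntries-∈⁺ (tabulate (child x)) childValues j))))

    grandchild∈extended : ∀ j k → (down (child x j) k , grandchildValue j k) ∈ extended
    grandchild∈extended F.zero F.zero = ∈-++⁺ʳ otherRowEntries (∈-++⁺ʳ firstRowEntries (∈-++⁺ʳ childEntries (here refl)))
    grandchild∈extended F.zero (F.suc k) = ∈-++⁺ʳ otherRowEntries (∈-++⁺ˡ
      (subst (λ w → (w , lookup firstRow k) ∈ firstRowEntries) (VP.lookup∘tabulate (λ k → down x₀ (F.suc k)) k)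
         (zipEntries-∈⁺ (tabulate (λ k → down x₀ (F.suc k))) firstRow k)))
    grandchild∈extended (F.suc j) k = ∈-++⁺ˡ
      (subst (λ w → (down w k , lookup (lookup otherRows j) k) ∈ otherRowEntries)
        (VP.lookup∘tabulate (λ j → child x (F.suc j)) j)
        (gridEntries-∈⁺ (tabulate (λ j → child x (F.suc j))) otherRows j k))

    NewEntry-functional : ∀ {y z z'} → NewEntry y z → NewEntry y z' → z ≡ z'
    NewEntry-functional (inj₁ (j , refl , refl)) (inj₁ (j' , q , refl)) with child-injective x q
    ... | refl = refl
    NewEntry-functional (inj₂ (j , k , refl , refl)) (inj₂ (j' , k' , q , refl)) with grandchild-injective x q
    ... | refl , refl = refl
    NewEntry-functional (inj₁ (j , refl , _)) (inj₂ (j' , k' , q , _)) = ⊥-elim (child≢grandchild j j' k' refl q)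
    NewEntry-functional (inj₂ (j , k , refl , _)) (inj₁ (j' , q , _)) = ⊥-elim (child≢grandchild j' j k refl (sym q))

    NewEntry-below : ∀ {y z} → NewEntry y z → Below x y
    NewEntry-below (inj₁ (j , a , _)) = inj₁ (j , a)
    NewEntry-below (inj₂ (j , k , a , _)) = inj₂ (j , k , a)

    childValues-sum : sumℤ (map (lookup childValues) (allFin (arity x))) ≡ S
    childValues-sum = trans (sum-tabulate (lookup childValues) childValues (λ i → refl))
                            (freshSplit-sum (suc (extra x)) S Bk)

    grandchildValues-sum : ∀ j → sumℤ (map (grandchildValue j) (allFin m)) ≡ + d Z.* lookup childValues j Z.- v
    grandchildValues-sum F.zero =
      trans (sum-tabulate (grandchildValue F.zero) (placed ∷ firstRow) (λ { F.zero → refl ; (F.suc k) → refl }))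
        (trans (cong (λ w → placed Z.+ w) (freshSplit-sum e X₀ B1)) (cancel placed (+ d Z.* y₀) v))
      where
      cancel : ∀ a b c → a Z.+ (b Z.- c Z.- a) ≡ b Z.- c
      cancel = solve-∀
    grandchildValues-sum (F.suc j) with splitRows-row v (tail childValues) B2 j
    ... | B' , row≡ = trans (sum-tabulate (grandchildValue (F.suc j)) (lookup otherRows j) (λ k → refl))
        (trans (cong sumV row≡) (trans (freshSplit-sum (suc e) _ B')
          (cong (λ w → + d Z.* w Z.- v) (lookup-tail childValues j))))

module Stages (e : ℕ) where
  open Tree e
  open Logs e
  open Enumeration
  open ListFacts

  HarmonicAt : Log → T → Set
  HarmonicAt Lg y = Σ ℤ λ a → (y , a) ∈ Lg × Σ (List ℤ) λ zs →
    Pointwise (λ y' z → (y' , z) ∈ Lg) (treeNbrs d y) zs × (+ length (treeNbrs d y)) Z.* a ≡ sumℤ zs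

  HarmonicAt-mono : ∀ {Lg Lg' y} → (∀ {en} → en ∈ Lg → en ∈ Lg') → HarmonicAt Lg y → HarmonicAt Lg' y
  HarmonicAt-mono Lg⊆Lg' (a , a∈ , zs , zs∈ , sum) = a , Lg⊆Lg' a∈ , zs , PW.map Lg⊆Lg' zs∈ , sum

  harmonicAt : ∀ {Lg y a} ns → treeNbrs d y ≡ ns → (y , a) ∈ Lg → ∀ zs →
    Pointwise (λ y' z → (y' , z) ∈ Lg) ns zs → (+ length ns) Z.* a ≡ sumℤ zs → HarmonicAt Lg y
  harmonicAt ns refl a∈ zs zs∈ sum = _ , a∈ , zs , zs∈ , sum

  record State : Set where
    constructor state
    field
      log : Log
      bound : ℕ
      done : List T
  open State

  open DecMembership _≟T_ using () renaming (_∈?_ to _∈T?_)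

  step : ℤ → State → T → State
  step t s x with x ∈T? done s
  ... | yes _ = s
  ... | no _ = state (Extend.extended t x (log s) (bound s)) (Extend.B3 t x (log s) (bound s)) (x ∷ done s)

  initial : State
  initial = state ((root , + 0) ∷ []) 0 []

  start : ℕ → State
  run : ℕ → State
  start zero = initial
  start (suc ℓ) = state (log (run ℓ)) (bound (run ℓ)) []
  run ℓ = foldl (step (enumℤ ℓ)) (start ℓ) (evenLevel ℓ)

  record Invariant (ℓ : ℕ) (s : State) : Set where
    field
      fresh : Fresh (values (log s)) (bound s)
      functional : ∀ {y z z'} → (y , z) ∈ log s → (y , z') ∈ log s → z ≡ z'
      located : ∀ {y z} → (y , z) ∈ log s → depth y ≤ ℓ N.+ ℓ ⊎ Σ T λ x → x ∈ done s × Below x y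
      processed : ∀ {x} → x ∈ done s →
        depth x ≡ ℓ N.+ ℓ × HarmonicAt (log s) x × (∀ j → HarmonicAt (log s) (child x j))
      covered : ∀ y → depth y ≤ ℓ N.+ ℓ → Σ ℤ λ z → (y , z) ∈ log s
      harmonic : ∀ y → depth y < ℓ N.+ ℓ → HarmonicAt (log s) y
      targets : ∀ k → k < ℓ → enumℤ k ∈ values (log s)
      target-now : ∀ {x} → x ∈ done s → enumℤ ℓ ∈ values (log s)
  open Invariant

  -- Processing x at depth 2ℓ makes x and all its children harmonic, because
  -- the children values sum to d·v − p and the grandchildren below the child c
  -- sum to d·φ(c) − v.
  module _ (ℓ : ℕ) (s : State) (I : Invariant ℓ s) where
    covered-entry : ∀ y → depth y ≤ ℓ N.+ ℓ → (y , valueIn y (log s)) ∈ log s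
    covered-entry y dy = valueIn-∈ (log s) (proj₂ (covered I y dy))

    split-off : ∀ a b → a ≡ b Z.+ (a Z.- b)
    split-off = solve-∀

    harmonic-at-processed : ∀ x → depth x ≡ ℓ N.+ ℓ → HarmonicAt (Extend.extended (enumℤ ℓ) x (log s) (bound s)) x
    harmonic-at-processed root depth-x =
      harmonicAt (map (child root) (allFin d)) refl (old⊆extended (covered-entry root (NP.≤-reflexive depth-x)))
        (map (lookup childValues) (allFin d)) (pointwise-tabulate (child root) (lookup childValues) child∈extended (allFin d))
        (trans (cong (λ n → + n Z.* v) (length-map-allFin d (child root)))
          (trans (sym (ZP.+-identityʳ _)) (sym childValues-sum)))
      where open Extend (enumℤ ℓ) root (log s) (bound s)
    harmonic-at-processed x@(node i ws) depth-x =
      harmonicAt (parent x ∷ map (child x) (allFin m)) (nbrs-node i ws)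
        (old⊆extended (covered-entry x (NP.≤-reflexive depth-x)))
        (p ∷ map (lookup childValues) (allFin m))
        (old⊆extended (covered-entry (parent x) depth-parent)
          ∷ pointwise-tabulate (child x) (lookup childValues) child∈extended (allFin m))
        (trans (cong (λ n → + suc n Z.* v) (length-map-allFin m (child x)))
          (trans (split-off (+ d Z.* v) p) (cong (λ w → p Z.+ w) (sym childValues-sum))))
      where
      open Extend (enumℤ ℓ) x (log s) (bound s)
      depth-parent : depth (parent x) ≤ ℓ N.+ ℓ
      depth-parent = NP.≤-trans (NP.n≤1+n _) (NP.≤-reflexive (trans (sym (depth-node i ws)) depth-x))

    harmonic-at-child : ∀ x → depth x ≡ ℓ N.+ ℓ → ∀ j →
      HarmonicAt (Extend.extended (enumℤ ℓ) x (log s) (bound s)) (child x j)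
    harmonic-at-child x depth-x j =
      harmonicAt (x ∷ map (down (child x j)) (allFin m)) (nbrs-child x j) (child∈extended j)
        (v ∷ map (grandchildValue j) (allFin m))
        (old⊆extended (covered-entry x (NP.≤-reflexive depth-x))
          ∷ pointwise-tabulate (down (child x j)) (grandchildValue j) (grandchild∈extended j) (allFin m))
        (trans (cong (λ n → + suc n Z.* lookup childValues j) (length-map-allFin m (down (child x j))))
          (trans (split-off (+ d Z.* lookup childValues j) v) (cong (λ w → v Z.+ w) (sym (grandchildValues-sum j)))))
      where open Extend (enumℤ ℓ) x (log s) (bound s)

  -- The new entries are for children and grandchildren of x, which
  -- had no entry before: they are deeper than 2ℓ and lie below no other
  -- processed vertex.
  module StepPreserves (ℓ : ℕ) (s : State) (I : Invariant ℓ s) (x : T)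
                       (x∈level : x ∈ evenLevel ℓ) (x∉done : x ∉ done s) where
    open Extend (enumℤ ℓ) x (log s) (bound s)

    depth-x : depth x ≡ ℓ N.+ ℓ
    depth-x = evenLevel-sound ℓ x x∈level

    new-unrecorded : ∀ {y z z'} → NewEntry y z → (y , z') ∈ log s → ⊥
    new-unrecorded new old with located I old
    ... | inj₁ shallow = NP.<⇒≱ (subst (_< _) depth-x (Below-deeper (NewEntry-below new))) shallow
    ... | inj₂ (x' , x'∈ , below) =
      x∉done (subst (_∈ done s) (Below-unique (trans (proj₁ (processed I x'∈)) (sym depth-x)) below (NewEntry-below new)) x'∈)

    extended-functional : ∀ {y z z'} → (y , z) ∈ extended → (y , z') ∈ extended → z ≡ z'
    extended-functional en en' with classify en | classify en'
    ... | inj₁ new | inj₁ new' = NewEntry-functional new new'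
    ... | inj₁ new | inj₂ old' = ⊥-elim (new-unrecorded new old')
    ... | inj₂ old | inj₁ new' = ⊥-elim (new-unrecorded new' old)
    ... | inj₂ old | inj₂ old' = functional I old old'

    extended-located : ∀ {y z} → (y , z) ∈ extended →
      depth y ≤ ℓ N.+ ℓ ⊎ Σ T λ x' → x' ∈ x ∷ done s × Below x' y
    extended-located en with classify en
    ... | inj₁ new = inj₂ (x , here refl , NewEntry-below new)
    ... | inj₂ old with located I old
    ...   | inj₁ shallow = inj₁ shallow
    ...   | inj₂ (x' , x'∈ , below) = inj₂ (x' , there x'∈ , below)

    extended-processed : ∀ {x'} → x' ∈ x ∷ done s →
      depth x' ≡ ℓ N.+ ℓ × HarmonicAt extended x' × (∀ j → HarmonicAt extended (child x' j))
    extended-processed (here refl) = depth-x , harmonic-at-processed ℓ s I x depth-x , harmonic-at-child ℓ s I x depth-x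
    extended-processed (there x'∈) with processed I x'∈
    ... | depth-x' , harmonic-x' , harmonic-children =
      depth-x' , HarmonicAt-mono old⊆extended harmonic-x' , λ j → HarmonicAt-mono old⊆extended (harmonic-children j)

    target-placed : enumℤ ℓ ∈ values extended
    target-placed with placed-target
    ... | inj₁ used = values-⊆ old⊆extended used
    ... | inj₂ placed≡t = subst (_∈ values extended) placed≡t (∈-map⁺ proj₂ (grandchild∈extended F.zero F.zero))

    invariant : Invariant ℓ (state extended B3 (x ∷ done s))
    invariant = record
      { fresh = extended-fresh (fresh I)
      ; functional = extended-functional
      ; located = extended-located
      ; processed = extended-processed
      ; covered = λ y dy → let (z , en) = covered I y dy in z , old⊆extended en
      ; harmonic = λ y dy → HarmonicAt-mono old⊆extended (harmonic I y dy)
      ; targets = λ k k<ℓ → values-⊆ old⊆extended (targets I k k<ℓ)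
      ; target-now = λ _ → target-placed
      }

  step-invariant : ∀ ℓ s x → Invariant ℓ s → x ∈ evenLevel ℓ → Invariant ℓ (step (enumℤ ℓ) s x)
  step-invariant ℓ s x I x∈level with x ∈T? done s
  ... | yes _ = I
  ... | no x∉done = StepPreserves.invariant ℓ s I x x∈level x∉done

  step-⊆ : ∀ t s x {en} → en ∈ log s → en ∈ log (step t s x)
  step-⊆ t s x en∈ with x ∈T? done s
  ... | yes _ = en∈
  ... | no _ = Extend.old⊆extended t x (log s) (bound s) en∈

  step-done : ∀ t s x {y} → y ∈ done s → y ∈ done (step t s x)
  step-done t s x y∈ with x ∈T? done s
  ... | yes _ = y∈
  ... | no _ = there y∈

  step-marks : ∀ t s x → x ∈ done (step t s x)
  step-marks t s x with x ∈T? done s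
  ... | yes x∈ = x∈
  ... | no _ = here refl

  steps-done : ∀ t s xs {y} → y ∈ done s → y ∈ done (foldl (step t) s xs)
  steps-done t s [] y∈ = y∈
  steps-done t s (x ∷ xs) y∈ = steps-done t (step t s x) xs (step-done t s x y∈)

  steps-⊆ : ∀ t s xs {en} → en ∈ log s → en ∈ log (foldl (step t) s xs)
  steps-⊆ t s [] en∈ = en∈
  steps-⊆ t s (x ∷ xs) en∈ = steps-⊆ t (step t s x) xs (step-⊆ t s x en∈)

  steps-invariant : ∀ ℓ s xs → Invariant ℓ s → (∀ {x} → x ∈ xs → x ∈ evenLevel ℓ) →
    Invariant ℓ (foldl (step (enumℤ ℓ)) s xs) × (∀ {x} → x ∈ xs → x ∈ done (foldl (step (enumℤ ℓ)) s xs))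
  steps-invariant ℓ s [] I _ = I , λ ()
  steps-invariant ℓ s (x ∷ xs) I xs⊆level
    with steps-invariant ℓ (step (enumℤ ℓ) s x) xs (step-invariant ℓ s x I (xs⊆level (here refl)))
                         (λ x'∈ → xs⊆level (there x'∈))
  ... | I' , all-done = I' , λ
    { (here refl) → steps-done (enumℤ ℓ) (step (enumℤ ℓ) s x) xs (step-marks (enumℤ ℓ) s x)
    ; (there x'∈) → all-done x'∈ }

  -- Once every vertex of depth 2ℓ is processed, all vertices of depth
  -- < 2ℓ + 2 are harmonic and all of depth ≤ 2ℓ + 2 have values, so the
  -- invariant holds for stage ℓ + 1 with nothing processed yet.
  module NextStage (ℓ : ℕ) (s : State) (I : Invariant ℓ s)
                   (all-done : ∀ x → x ∈ evenLevel ℓ → x ∈ done s) where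
    two-more : suc ℓ N.+ suc ℓ ≡ suc (suc (ℓ N.+ ℓ))
    two-more = cong suc (NP.+-suc ℓ ℓ)

    harmonic-next : ∀ y → depth y < suc ℓ N.+ suc ℓ → HarmonicAt (log s) y
    harmonic-next y dy with NP.<-cmp (depth y) (ℓ N.+ ℓ)
    ... | tri< shallower _ _ = harmonic I y shallower
    ... | tri≈ _ same _ = proj₁ (proj₂ (processed I (all-done y (evenLevel-complete ℓ y same))))
    ... | tri> _ _ deeper with odd-level-child ℓ y (NP.≤-antisym depth≤ deeper)
      where
      depth≤ : depth y ≤ suc (ℓ N.+ ℓ)
      depth≤ = NP.≤-pred (subst (suc (depth y) ≤_) two-more dy)
    ...   | x , depth-x , j , refl = proj₂ (proj₂ (processed I (all-done x (evenLevel-complete ℓ x depth-x)))) j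

    -- A vertex has a value because its parent is harmonic.
    covered-next : ∀ y → depth y ≤ suc ℓ N.+ suc ℓ → Σ ℤ λ z → (y , z) ∈ log s
    covered-next root _ = covered I root z≤n
    covered-next (node i ws) dy with harmonic-next (parent (node i ws)) (subst (_≤ suc ℓ N.+ suc ℓ) (depth-node i ws) dy)
    ... | _ , _ , _ , neighbours , _ = pointwise-∈ neighbours (node∈nbrs-parent i ws)

    located-next : ∀ {y z} → (y , z) ∈ log s → depth y ≤ suc ℓ N.+ suc ℓ ⊎ Σ T λ x → x ∈ [] × Below x y
    located-next en with located I en
    ... | inj₁ shallow = inj₁ (NP.≤-trans shallow (NP.≤-trans (NP.m≤n+m (ℓ N.+ ℓ) 2) (NP.≤-reflexive (sym two-more))))
    ... | inj₂ (x , x∈ , below) = inj₁ (NP.≤-trans (Below-shallow below)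
          (NP.≤-reflexive (trans (cong (λ n → suc (suc n)) (proj₁ (processed I x∈))) (sym two-more))))

    targets-next : ∀ k → k < suc ℓ → enumℤ k ∈ values (log s)
    targets-next k k<1+ℓ with NP.m<1+n⇒m<n∨m≡n k<1+ℓ
    ... | inj₁ k<ℓ = targets I k k<ℓ
    ... | inj₂ refl = target-now I (all-done _ (proj₂ (evenLevel-inhabited ℓ)))

    invariant : Invariant (suc ℓ) (state (log s) (bound s) [])
    invariant = record
      { fresh = fresh I
      ; functional = functional I
      ; located = located-next
      ; processed = λ ()
      ; covered = covered-next
      ; harmonic = harmonic-next
      ; targets = targets-next
      ; target-now = λ ()
      }

  initial-invariant : Invariant 0 initial
  initial-invariant = record
    { fresh = ([] ∷ []) , (z≤n ∷ [])
    ; functional = λ { (here refl) (here refl) → refl }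
    ; located = λ { (here refl) → inj₁ z≤n }
    ; processed = λ ()
    ; covered = λ { root _ → + 0 , here refl ; (node i ws) () }
    ; harmonic = λ y ()
    ; targets = λ k ()
    ; target-now = λ ()
    }

  run-invariant : ∀ ℓ → Invariant ℓ (run ℓ) × (∀ x → x ∈ evenLevel ℓ → x ∈ done (run ℓ))
  start-invariant : ∀ ℓ → Invariant ℓ (start ℓ)
  run-invariant ℓ with steps-invariant ℓ (start ℓ) (evenLevel ℓ) (start-invariant ℓ) (λ x∈ → x∈)
  ... | I , all-done = I , λ _ x∈ → all-done x∈
  start-invariant zero = initial-invariant
  start-invariant (suc ℓ) = NextStage.invariant ℓ (run ℓ) (proj₁ (run-invariant ℓ)) (proj₂ (run-invariant ℓ))

  run-⊆ : ∀ ℓ {en} → en ∈ log (run ℓ) → en ∈ log (run (suc ℓ))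
  run-⊆ ℓ = steps-⊆ (enumℤ (suc ℓ)) (start (suc ℓ)) (evenLevel (suc ℓ))

-- Logs only grow and stay functional, so every later
-- log agrees with φ; hence φ is harmonic (invariant at a late enough stage),
-- injective (the values of a log are distinct) and surjective (each
-- enumℤ k is used by the end of stage k).
module Limit (e : ℕ) where
  open Tree e
  open Logs e
  open Enumeration
  open Stages e
  open State
  open Invariant

  φ : T → ℤ
  φ y = valueIn y (log (run (depth y)))

  run-mono : ∀ {ℓ ℓ'} → ℓ ≤ ℓ' → ∀ {en} → en ∈ log (run ℓ) → en ∈ log (run ℓ')
  run-mono ℓ≤ℓ' = go (NP.≤⇒≤′ ℓ≤ℓ')
    where
    go : ∀ {ℓ ℓ'} → ℓ ≤′ ℓ' → ∀ {en} → en ∈ log (run ℓ) → en ∈ log (run ℓ')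
    go (≤′-reflexive refl) en∈ = en∈
    go {ℓ' = suc ℓ'} (≤′-step ℓ≤′ℓ') en∈ = run-⊆ ℓ' (go ℓ≤′ℓ' en∈)

  -- At the start of stage n + 1 (log = log of run n) the vertex y of depth n
  -- has a value and is harmonic.
  n<2n+2 : ∀ n → n < suc n N.+ suc n
  n<2n+2 n = s≤s (NP.m≤m+n n (suc n))

  φ-entry : ∀ y → (y , φ y) ∈ log (run (depth y))
  φ-entry y = valueIn-∈ _ (proj₂ (covered (start-invariant (suc (depth y))) y (NP.<⇒≤ (n<2n+2 (depth y)))))

  φ-agrees : ∀ ℓ {y z} → (y , z) ∈ log (run ℓ) → φ y ≡ z
  φ-agrees ℓ {y} en = functional (start-invariant (suc (ℓ ⊔ depth y)))
    (run-mono (NP.m≤n⊔m ℓ (depth y)) (φ-entry y)) (run-mono (NP.m≤m⊔n ℓ (depth y)) en)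

  φ-agrees-pointwise : ∀ ℓ {ys zs} → Pointwise (λ y z → (y , z) ∈ log (run ℓ)) ys zs → map φ ys ≡ zs
  φ-agrees-pointwise ℓ [] = refl
  φ-agrees-pointwise ℓ (en ∷ ens) = cong₂ _∷_ (φ-agrees ℓ en) (φ-agrees-pointwise ℓ ens)

  φ-harmonic : Harmonic (RegularTree d) φ
  φ-harmonic y with harmonic (start-invariant (suc (depth y))) y (n<2n+2 (depth y))
  ... | a , a∈ , zs , zs∈ , sum =
    trans (cong (λ w → + length (treeNbrs d y) Z.* w) (φ-agrees (depth y) a∈))
      (trans sum (sym (cong sumℤ (φ-agrees-pointwise (depth y) zs∈))))

  distinct-values-injective : ∀ (Lg : Log) → Unique (values Lg) → ∀ {a b z} → (a , z) ∈ Lg → (b , z) ∈ Lg → a ≡ b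
  distinct-values-injective (_ ∷ Lg) (_ ∷ _) (here refl) (here refl) = refl
  distinct-values-injective (_ ∷ Lg) (z∉ ∷ _) (here refl) (there b∈) = ⊥-elim (All.lookup z∉ (∈-map⁺ proj₂ b∈) refl)
  distinct-values-injective (_ ∷ Lg) (z∉ ∷ _) (there a∈) (here refl) = ⊥-elim (All.lookup z∉ (∈-map⁺ proj₂ a∈) refl)
  distinct-values-injective (_ ∷ Lg) (_ ∷ unique) (there a∈) (there b∈) = distinct-values-injective Lg unique a∈ b∈

  φ-injective : Injective _≡_ _≡_ φ
  φ-injective {y₁} {y₂} φy₁≡φy₂ =
    distinct-values-injective (log (run ℓ)) (proj₁ (fresh (start-invariant (suc ℓ))))
      (run-mono (NP.m≤m⊔n (depth y₁) (depth y₂)) (φ-entry y₁))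
      (subst (λ w → (y₂ , w) ∈ log (run ℓ)) (sym φy₁≡φy₂) (run-mono (NP.m≤n⊔m (depth y₁) (depth y₂)) (φ-entry y₂)))
    where ℓ = depth y₁ ⊔ depth y₂

  φ-surjective : Surjective _≡_ _≡_ φ
  φ-surjective z with enumℤ-surjective z
  ... | k , refl with ∈-map⁻ proj₂ (targets (start-invariant (suc k)) k (NP.n<1+n k))
  ...   | (y , _) , en , refl = y , λ { refl → φ-agrees k en }

  treeLabeling : HarmonicLabeling (RegularTree d) φ
  treeLabeling = φ-harmonic , φ-injective , φ-surjective

mainTheorem1 : (d : ℕ) → d ≥ 2 →
    ∃ λ (φ : V (RegularTree d) → ℤ) → HarmonicLabeling (RegularTree d) φ
mainTheorem1 (suc (suc zero)) _ = Path.signedDepth , Path.pathLabeling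
mainTheorem1 (suc (suc (suc e))) _ = Limit.φ e , Limit.treeLabeling e
mainTheorem1 (suc zero) (s≤s ())
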